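{- For all lengths $a,b,c$: (irreflexivity) not $a<a$; (transitivity) if $a<b$ and $b<c$ then $a<c$.
   Context: Synthetic plane geometry with classical logic. Primitive notions: points, lines (with equality), incidence $A\in x$, a ternary betweenness relation $\mathrm{Bet}(A,B,C)$ ("$B$ strictly between $A$ and $C$"), a type of lengths with a map $(A,B)\mapsto|AB|$ such that every length equals $|AB|$ for some $A,B$. Points are collinear if some line contains all of them. Axioms: (incidence) there is a point; for every point there is a distinct point; every line has a point; for every line $x$ and $A\in x$ there is $B\in x$, $B\neq A$; for every line there is a point not on it; through two distinct points there is a line; if $A\neq B$, $A,B\in x$ and $x\neq y$ then $A\notin y$ or $B\notin y$. (betweenness) if $\mathrm{Bet}(A,B,C)$ then $A\neq C$, $A,B,C$ collinear, $\mathrm{Bet}(C,B,A)$, and not $\mathrm{Bet}(B,A,C)$. (lengths) $|AB|=|CC|$ iff $A=B$; $|AB|=|BA|$. (line–circle) for $O,A,B$ with $A\neq O$ there is $C$ with ($\mathrm{Bet}(A,O,C)$ or $O=C$) and $|OB|=|OC|$. "$P,Q$ on opposite sides of line $x$": $P,Q\notin x$ and some $O\in x$ has $\mathrm{Bet}(P,O,Q)$; "same side": $P,Q\notin x$ and no such $O$. (Pasch) if $P,Q$ are on opposite sides of $x$ and $R\notin x$, then $P,R$ or $R,Q$ are on opposite sides of $x$. Write $\mathrm{SR}(O,P,Q)$ for: $O\neq P$, $O\neq Q$, $O,P,Q$ collinear, not $\mathrm{Bet}(P,O,Q)$. (concentric circles) for points $O,A,A',B,B'$: if $\mathrm{Bet}(O,A,B)$,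 $\mathrm{SR}(O,A',B')$, $|OA|=|OA'|$ and $|OB|=|OB'|$, then $\mathrm{Bet}(O,A',B')$ and $|AB|=|A'B'|$. (circle–circle) for points $O,A,B,O',A',B',P$: if $O,O',P$ are not collinear, $\mathrm{Bet}$ holds for each of the triples $(A,A',B),(A,A',B'),(A,B,B'),(A',B,B')$, $\mathrm{Bet}(A,O,B)$ with $|OA|=|OB|$, and $\mathrm{Bet}(A',O',B')$ with $|O'A'|=|O'B'|$, then there is a point $Q$ with $P,Q$ on the same side of the line through $O,O'$, $|OQ|=|OA|$ and $|O'Q|=|O'A'|$. Order: $a<b$ iff there are points $A,B,C$ with $|AB|=a$, $|AC|=b$ and ($\mathrm{Bet}(A,B,C)$ or ($A=B$ and $B\neq C$)). -}

module Defs where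

open import Level using (Level; _⊔_; suc)
open import Data.Product using (Σ; ∃; _×_; _,_)
open import Data.Sum using (_⊎_)
open import Data.Empty using (⊥)
open import Relation.Nullary using (¬_)
open import Relation.Binary.PropositionalEquality using (_≡_)

ExcludedMiddle : (ℓ : Level) → Set (suc ℓ)
ExcludedMiddle ℓ = (P : Set ℓ) → P ⊎ ¬ P

record Geometry (ℓ : Level) : Set (suc ℓ) where
  field
    Point  : Set ℓ
    Line   : Set ℓ
    Length : Set ℓ
    _∈_    : Point → Line → Set ℓ
    Bet    : Point → Point → Point → Set ℓ
    len    : Point → Point → Length

  Collinear : Point → Point → Point → Set ℓ
  Collinear A B C = Σ Line λ x → A ∈ x × B ∈ x × C ∈ x

  OppositeSides : Point → Point → Line → Set ℓ
  OppositeSides P Q x = ¬ (P ∈ x) × ¬ (Q ∈ x) × Σ Point λ O → O ∈ x × Bet P O Q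

  SameSide : Point → Point → Line → Set ℓ
  SameSide P Q x = ¬ (P ∈ x) × ¬ (Q ∈ x) × ¬ (Σ Point λ O → O ∈ x × Bet P O Q)

  SR : Point → Point → Point → Set ℓ
  SR O P Q = ¬ (O ≡ P) × ¬ (O ≡ Q) × Collinear O P Q × ¬ Bet P O Q

  field
    len-surj : (a : Length) → Σ Point λ A → Σ Point λ B → len A B ≡ a
    point-exists   : Point
    other-point    : (A : Point) → Σ Point λ B → ¬ (B ≡ A)
    line-has-point : (x : Line) → Σ Point λ A → A ∈ x
    line-two-points : (x : Line) (A : Point) → A ∈ x →
                      Σ Point λ B → B ∈ x × ¬ (B ≡ A)
    point-off-line : (x : Line) → Σ Point λ A → ¬ (A ∈ x)
    line-through   : (A B : Point) → ¬ (A ≡ B) → Σ Line λ x → A ∈ x × B ∈ x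
    line-unique    : (A B : Point) (x y : Line) → ¬ (A ≡ B) → A ∈ x → B ∈ x →
                     ¬ (x ≡ y) → ¬ (A ∈ y) ⊎ ¬ (B ∈ y)
    bet-neq   : ∀ {A B C} → Bet A B C → ¬ (A ≡ C)
    bet-col   : ∀ {A B C} → Bet A B C → Collinear A B C
    bet-sym   : ∀ {A B C} → Bet A B C → Bet C B A
    bet-not   : ∀ {A B C} → Bet A B C → ¬ Bet B A C
    len-zero  : ∀ A B C → (len A B ≡ len C C → A ≡ B) × (A ≡ B → len A B ≡ len C C)
    len-sym   : ∀ A B → len A B ≡ len B A
    line-circle : ∀ O A B → ¬ (A ≡ O) →
                  Σ Point λ C → (Bet A O C ⊎ O ≡ C) × len O B ≡ len O C
    pasch : ∀ P Q R x → OppositeSides P Q x → ¬ (R ∈ x) →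
            OppositeSides P R x ⊎ OppositeSides R Q x
    concentric : ∀ O A A' B B' → Bet O A B → SR O A' B' →
                 len O A ≡ len O A' → len O B ≡ len O B' →
                 Bet O A' B' × len A B ≡ len A' B'
    circle-circle : ∀ O A B O' A' B' P →
                    ¬ Collinear O O' P →
                    Bet A A' B → Bet A A' B' → Bet A B B' → Bet A' B B' →
                    Bet A O B → len O A ≡ len O B →
                    Bet A' O' B' → len O' A' ≡ len O' B' →
                    Σ Point λ Q → ((x : Line) → O ∈ x → O' ∈ x → SameSide P Q x) ×
                                  len O Q ≡ len O A × len O' Q ≡ len O' A'

  _<_ : Length → Length → Set ℓ
  a < b = Σ Point λ A → Σ Point λ B → Σ Point λ C →
          len A B ≡ a × len A C ≡ b × (Bet A B C ⊎ (A ≡ B × ¬ (B ≡ C)))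

module Submission where

-- Pasch's axiom gives Hilbert's order lemmas on a line: of three distinct collinear points one lies
-- between the other two, and betweenness chains transitively.  Irreflexivity is then the concentric
-- circles axiom: Bet A B C together with |AB| = |AC| would force Bet A C B.  For transitivity a
-- segment D–E–F is carried to the vertex A of the smaller one as in Euclid I.2 (through the apex G of
-- an equilateral triangle on AD, obtained from the circle–circle axiom, followed by rotations about G
-- via concentric circles), and finally rotated about A until E falls on the endpoint of the smaller
-- segment.

open import Defs
open import Level using (Level)
open import Data.Product using (_×_; _,_; Σ; proj₁; proj₂)
open import Data.Sum as Sum using (_⊎_; inj₁; inj₂)
open import Data.Empty using (⊥-elim)
open import Function using (_∘_; id)
open import Relation.Nullary using (¬_)
open import Relation.Binary.PropositionalEquality using (_≡_; refl; sym; trans; subst; module ≡-Reasoning)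

module LengthOrder {ℓ : Level} (em : ExcludedMiddle ℓ) (𝒢 : Geometry ℓ) where
  open Geometry 𝒢
  open ≡-Reasoning

  bet-neq₁₂ : ∀ {A B C} → Bet A B C → ¬ A ≡ B
  bet-neq₁₂ ABC refl = bet-not ABC ABC

  bet-neq₂₃ : ∀ {A B C} → Bet A B C → ¬ B ≡ C
  bet-neq₂₃ ABC = bet-neq₁₂ (bet-sym ABC) ∘ sym

  bet-not₂₃ : ∀ {A B C} → Bet A B C → ¬ Bet A C B
  bet-not₂₃ ABC ACB = bet-not (bet-sym ACB) (bet-sym ABC)

  zero-radius : ∀ {O X Y} → len O X ≡ len O Y → O ≡ Y → O ≡ X
  zero-radius {O} {X} r refl = proj₁ (len-zero O X O) r

  nonzero-radius : ∀ {O X Y} → len O X ≡ len O Y → ¬ O ≡ X → ¬ O ≡ Y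
  nonzero-radius r O≢X = O≢X ∘ zero-radius r

  len-null : ∀ A B → len A A ≡ len B B
  len-null A B = proj₂ (len-zero A A B) refl

  extension : ∀ {A O} → ¬ A ≡ O → ∀ B → ¬ O ≡ B → Σ Point λ C → Bet A O C × len O C ≡ len O B
  extension {A} {O} A≢O B O≢B with line-circle O A B A≢O
  ... | C , inj₁ AOC , r = C , AOC , sym r
  ... | C , inj₂ O≡C , r = ⊥-elim (O≢B (zero-radius r O≡C))

  lines-≡ : ∀ {A B x y} → ¬ A ≡ B → A ∈ x → B ∈ x → A ∈ y → B ∈ y → x ≡ y
  lines-≡ {A} {B} {x} {y} A≢B Ax Bx Ay By with em (x ≡ y)
  ... | inj₁ x≡y = x≡y
  ... | inj₂ x≢y with line-unique A B x y A≢B Ax Bx x≢y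
  ...   | inj₁ A∉y = ⊥-elim (A∉y Ay)
  ...   | inj₂ B∉y = ⊥-elim (B∉y By)

  meet-≡ : ∀ {A B x y} → ¬ x ≡ y → A ∈ x → A ∈ y → B ∈ x → B ∈ y → A ≡ B
  meet-≡ {A} {B} x≢y Ax Ay Bx By with em (A ≡ B)
  ... | inj₁ A≡B = A≡B
  ... | inj₂ A≢B = ⊥-elim (x≢y (lines-≡ A≢B Ax Bx Ay By))

  ≢-line : ∀ {N x l} → ¬ N ∈ l → N ∈ x → ¬ x ≡ l
  ≢-line {N} N∉l Nx x≡l = N∉l (subst (N ∈_) x≡l Nx)

  bet-on₁ : ∀ {A B C x} → Bet A B C → B ∈ x → C ∈ x → A ∈ x
  bet-on₁ {A = A} ABC Bx Cx with bet-col ABC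
  ... | z , Az , Bz , Cz = subst (A ∈_) (lines-≡ (bet-neq₂₃ ABC) Bz Cz Bx Cx) Az

  bet-on₂ : ∀ {A B C x} → Bet A B C → A ∈ x → C ∈ x → B ∈ x
  bet-on₂ {B = B} ABC Ax Cx with bet-col ABC
  ... | z , Az , Bz , Cz = subst (B ∈_) (lines-≡ (bet-neq ABC) Az Cz Ax Cx) Bz

  bet-on₃ : ∀ {A B C x} → Bet A B C → A ∈ x → B ∈ x → C ∈ x
  bet-on₃ {C = C} ABC Ax Bx with bet-col ABC
  ... | z , Az , Bz , Cz = subst (C ∈_) (lines-≡ (bet-neq₁₂ ABC) Az Bz Ax Bx) Cz

  off-line-≢ : ∀ {N P l} → ¬ N ∈ l → P ∈ l → ¬ P ≡ N
  off-line-≢ {l = l} N∉l Pl P≡N = N∉l (subst (_∈ l) P≡N Pl)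

  join-off-line : ∀ {N M l} → ¬ N ∈ l → M ∈ l →
                  Σ Line λ x → M ∈ x × N ∈ x × (∀ {S} → S ∈ l → ¬ S ≡ M → ¬ S ∈ x)
  join-off-line {N} {M} {l} N∉l Ml with line-through M N (off-line-≢ N∉l Ml)
  ... | x , Mx , Nx = x , Mx , Nx , λ Sl S≢M Sx → N∉l (subst (N ∈_) (lines-≡ S≢M Sx Mx Sl Ml) Nx)

  Crosses : Line → Point → Point → Set ℓ
  Crosses x P Q = Σ Point λ O → O ∈ x × Bet P O Q

  pasch′ : ∀ {P M Q R x} → Bet P M Q → M ∈ x → ¬ P ∈ x → ¬ Q ∈ x → ¬ R ∈ x →
           Crosses x P R ⊎ Crosses x R Q
  pasch′ {P} {M} {Q} {R} {x} PMQ Mx P∉x Q∉x R∉x =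
    Sum.map (proj₂ ∘ proj₂) (proj₂ ∘ proj₂) (pasch P Q R x (P∉x , Q∉x , M , Mx , PMQ) R∉x)

  crossing-at : ∀ {P Q X x k} → ¬ x ≡ k → P ∈ k → Q ∈ k → X ∈ x → X ∈ k → Crosses x P Q → Bet P X Q
  crossing-at {P} {Q} x≢k Pk Qk Xx Xk (O , Ox , POQ) =
    subst (λ Z → Bet P Z Q) (meet-≡ x≢k Ox (bet-on₂ POQ Pk Qk) Xx Xk) POQ

  bet-either-side : ∀ {P M Q R l} → Bet P M Q → P ∈ l → Q ∈ l → R ∈ l → ¬ R ≡ M →
                    Bet P M R ⊎ Bet R M Q
  bet-either-side {P} {M} {Q} {R} {l} PMQ Pl Ql Rl R≢M =
    let Ml = bet-on₂ PMQ Pl Ql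
        N , N∉l = point-off-line l
        x , Mx , Nx , off-x = join-off-line N∉l Ml
        x≢l = ≢-line N∉l Nx
    in Sum.map (crossing-at x≢l Pl Rl Mx Ml) (crossing-at x≢l Rl Ql Mx Ml)
               (pasch′ PMQ Mx (off-x Pl (bet-neq₁₂ PMQ)) (off-x Ql (bet-neq₂₃ PMQ ∘ sym)) (off-x Rl R≢M))

  pasch-cevian : ∀ {B X Y D G l x} → B ∈ l → X ∈ l → Y ∈ l → ¬ B ≡ X → ¬ Y ≡ X → ¬ D ∈ l →
                 X ∈ x → D ∈ x → (∀ {S} → S ∈ l → ¬ S ≡ X → ¬ S ∈ x) →
                 Bet B D G → ¬ Bet B X Y → Σ Point λ E → E ∈ x × Bet Y E G
  pasch-cevian {B} {x = x} Bl Xl Yl B≢X Y≢X D∉l Xx Dx off-x BDG ¬BXY =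
    Sum.[ (λ cross → ⊥-elim (¬BXY (crossing-at (≢-line D∉l Dx) Bl Yl Xx Xl cross))) , id ]
        (pasch′ BDG Dx B∉x (B∉x ∘ bet-on₁ BDG Dx) (off-x Yl Y≢X))
    where
    B∉x : ¬ B ∈ x
    B∉x = off-x Bl B≢X

  -- Hilbert's argument: take G beyond a point D off l on BD; Pasch in BGC and BGA gives E on CG ∩ AD
  -- and F on AG ∩ CD, then Pasch in AGE gives Bet A D E, and Pasch in AEC puts B between A and C.
  bet-from-¬bet : ∀ {A B C l} → A ∈ l → B ∈ l → C ∈ l → ¬ A ≡ B → ¬ B ≡ C → ¬ A ≡ C →
                  ¬ Bet B A C → ¬ Bet A C B → Bet A B C
  bet-from-¬bet {A} {B} {C} {l} Al Bl Cl A≢B B≢C A≢C ¬BAC ¬ACB with point-off-line l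
  ... | D , D∉l with extension (off-line-≢ D∉l Bl) B (off-line-≢ D∉l Bl ∘ sym)
  ... | G , BDG , _ with join-off-line D∉l Al | join-off-line D∉l Bl | join-off-line D∉l Cl
  ... | a , Aa , Da , off-a | g , Bg , Dg , off-g | c , Cc , Dc , off-c
    with pasch-cevian Bl Al Cl (A≢B ∘ sym) (A≢C ∘ sym) D∉l Aa Da off-a BDG ¬BAC
       | pasch-cevian Bl Cl Al B≢C A≢C D∉l Cc Dc off-c BDG (¬ACB ∘ bet-sym)
  ... | E , Ea , CEG | F , Fc , AFG with bet-col CEG
  ... | k , Ck , Ek , Gk =
    Sum.[ crossing-at (≢-line D∉l Dg) Al Cl Bg Bl
        , (λ cross → ⊥-elim (bet-not₂₃ CEG (crossing-at g≢k Ck Ek Gg Gk cross))) ]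
        (pasch′ ADE Dg (off-g Al A≢B) E∉g C∉g)
    where
    Gg : G ∈ g
    Gg = bet-on₃ BDG Bg Dg
    A∉c : ¬ A ∈ c
    A∉c = off-c Al A≢C
    G∉c : ¬ G ∈ c
    G∉c Gc = off-c Bl B≢C (bet-on₁ BDG Dc Gc)
    E∉c : ¬ E ∈ c
    E∉c Ec = G∉c (bet-on₃ CEG Cc Ec)
    C∉g : ¬ C ∈ g
    C∉g = off-g Cl (B≢C ∘ sym)
    c≢a : ¬ c ≡ a
    c≢a c≡a = A∉c (subst (A ∈_) (sym c≡a) Aa)
    c≢k : ¬ c ≡ k
    c≢k c≡k = G∉c (subst (G ∈_) (sym c≡k) Gk)
    g≢k : ¬ g ≡ k
    g≢k g≡k = C∉g (subst (C ∈_) (sym g≡k) Ck)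
    ADE : Bet A D E
    ADE = Sum.[ crossing-at c≢a Aa Ea Dc Da
              , (λ cross → ⊥-elim (bet-not CEG (crossing-at c≢k Ek Gk Cc Ck cross))) ]
              (pasch′ AFG Fc A∉c G∉c E∉c)
    E∉g : ¬ E ∈ g
    E∉g Eg = off-a Bl (A≢B ∘ sym) (subst (B ∈_) (lines-≡ (bet-neq₂₃ ADE) Dg Eg Da Ea) Bg)

  bet-trichotomy : ∀ {A B C l} → A ∈ l → B ∈ l → C ∈ l → ¬ A ≡ B → ¬ B ≡ C → ¬ A ≡ C →
                   Bet A B C ⊎ Bet B A C ⊎ Bet A C B
  bet-trichotomy {A} {B} {C} Al Bl Cl A≢B B≢C A≢C with em (Bet B A C) | em (Bet A C B)
  ... | inj₁ BAC | _        = inj₂ (inj₁ BAC)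
  ... | inj₂ _   | inj₁ ACB = inj₂ (inj₂ ACB)
  ... | inj₂ ¬BAC | inj₂ ¬ACB = inj₁ (bet-from-¬bet Al Bl Cl A≢B B≢C A≢C ¬BAC ¬ACB)

  bet-same-ray : ∀ {W O U V} → Bet W O U → Bet W O V → ¬ Bet U O V
  bet-same-ray {W} {O} {U} {V} WOU WOV UOV with bet-col WOU
  ... | z , Wz , Oz , Uz =
    Sum.[ (λ UVW → ¬between-ends Uz Wz UVW UOV WOV)
        , Sum.[ (λ VUW → ¬between-ends Vz Wz VUW (bet-sym UOV) WOU)
              , (λ UWV → ¬between-ends Uz Vz UWV (bet-sym WOU) (bet-sym WOV)) ] ]
        (bet-trichotomy Uz Vz Wz (bet-neq UOV) (bet-neq WOV ∘ sym) (bet-neq WOU ∘ sym))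
    where
    Vz : V ∈ z
    Vz = bet-on₃ WOV Wz Oz
    ¬between-ends : ∀ {X Y Z} → X ∈ z → Z ∈ z → Bet X Y Z → Bet X O Y → ¬ Bet Z O Y
    ¬between-ends Xz Zz XYZ XOY ZOY with bet-either-side XYZ Xz Zz Oz (bet-neq₂₃ XOY)
    ... | inj₁ XYO = bet-not₂₃ XOY XYO
    ... | inj₂ OYZ = bet-not (bet-sym ZOY) OYZ

  bet-bet⇒SR : ∀ {W O U V} → Bet W O U → Bet W O V → SR O U V
  bet-bet⇒SR WOU WOV with bet-col WOU
  ... | z , Wz , Oz , Uz = bet-neq₂₃ WOU , bet-neq₂₃ WOV , (z , Oz , Uz , bet-on₃ WOV Wz Oz) , bet-same-ray WOU WOV

  bet-outer-trans : ∀ {O X Y Z} → Bet O X Y → Bet X Y Z → Bet O Y Z × Bet O X Z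
  bet-outer-trans {O} {X} {Y} {Z} OXY XYZ with bet-col XYZ
  ... | z , Xz , Yz , Zz =
    Sum.[ (λ XYO → ⊥-elim (bet-not₂₃ OXY (bet-sym XYO))) , id ] (bet-either-side XYZ Xz Zz Oz (bet-neq OXY)) ,
    Sum.[ id , (λ ZXY → ⊥-elim (bet-not XYZ (bet-sym ZXY))) ] (bet-either-side OXY Oz Yz Zz (bet-neq XYZ ∘ sym))
    where
    Oz : O ∈ z
    Oz = bet-on₁ OXY Xz Yz

  bet-inner-trans : ∀ {O X Y Z} → Bet O X Y → Bet O Y Z → Bet X Y Z × Bet O X Z
  bet-inner-trans {O} {X} {Y} {Z} OXY OYZ with bet-col OYZ
  ... | z , Oz , Yz , Zz with bet-either-side OYZ Oz Zz (bet-on₂ OXY Oz Yz) (bet-neq₂₃ OXY)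
  ... | inj₁ OYX = ⊥-elim (bet-not₂₃ OXY OYX)
  ... | inj₂ XYZ = XYZ , proj₂ (bet-outer-trans OXY XYZ)

  rotate : ∀ {W G X Y X′} → Bet W G X′ → Bet G X Y → len G X ≡ len G X′ →
           Σ Point λ Y′ → Bet W G Y′ × len G Y ≡ len G Y′ × Bet G X′ Y′ × len X Y ≡ len X′ Y′
  rotate {W} {G} {X} {Y} {X′} WGX′ GXY r =
    let Y′ , WGY′ , GY′ = extension (bet-neq₁₂ WGX′) Y (bet-neq GXY)
    in Y′ , WGY′ , sym GY′ , concentric G X X′ Y Y′ GXY (bet-bet⇒SR WGX′ WGY′) r (sym GY′)

  off-line-noncollinear : ∀ {A D P l} → ¬ A ≡ D → A ∈ l → D ∈ l → ¬ P ∈ l → ¬ Collinear A D P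
  off-line-noncollinear {P = P} A≢D Al Dl P∉l (z , Az , Dz , Pz) = P∉l (subst (P ∈_) (lines-≡ A≢D Az Dz Al Dl) Pz)

  equilateral-apex : ∀ {A D} → ¬ A ≡ D → Σ Point λ G → len A G ≡ len A D × len D G ≡ len D A
  equilateral-apex {A} {D} A≢D =
    let D₁ , DAD₁ , AD₁ = extension (A≢D ∘ sym) D A≢D
        A₂ , ADA₂ , DA₂ = extension A≢D A (A≢D ∘ sym)
        D₁DA₂ , D₁AA₂ = bet-outer-trans (bet-sym DAD₁) ADA₂
        l , Al , Dl = line-through A D A≢D
        P , P∉l = point-off-line l
        G , _ , AG , DG = circle-circle A D₁ D D A A₂ P (off-line-noncollinear A≢D Al Dl P∉l)
                            (bet-sym DAD₁) D₁AA₂ D₁DA₂ ADA₂ (bet-sym DAD₁) AD₁ ADA₂ (sym DA₂)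
    in G , trans AG AD₁ , DG

  extend-beyond : ∀ {G D E F} → ¬ G ≡ D → Bet D E F →
                  Σ Point λ E₁ → Σ Point λ F₁ → Bet G D E₁ × Bet G E₁ F₁ × len D E₁ ≡ len D E × len D F₁ ≡ len D F
  extend-beyond {G} {D} {E} {F} G≢D DEF =
    let E₁ , GDE₁ , DE₁ = extension G≢D E (bet-neq₁₂ DEF)
        F₁ , _ , DF₁ , DE₁F₁ , _ = rotate GDE₁ DEF (sym DE₁)
    in E₁ , F₁ , GDE₁ , proj₁ (bet-outer-trans GDE₁ DE₁F₁) , DE₁ , sym DF₁

  rotate-onto : ∀ {G D A E F} → len G D ≡ len G A → ¬ G ≡ A → Bet G D E → Bet G E F →
                Σ Point λ E′ → Σ Point λ F′ → Bet A E′ F′ × len A E′ ≡ len D E × len A F′ ≡ len D F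
  rotate-onto {G} {D} {A} {E} {F} GD≡GA G≢A GDE GEF =
    let W , AGW , _ = extension (G≢A ∘ sym) A G≢A
        E′ , WGE′ , GE≡GE′ , GAE′ , DE≡AE′ = rotate (bet-sym AGW) GDE GD≡GA
        F′ , WGF′ , GF≡GF′ , _ , DF≡AF′ = rotate (bet-sym AGW) (proj₂ (bet-inner-trans GDE GEF)) GD≡GA
        GE′F′ = proj₁ (concentric G E E′ F F′ GEF (bet-bet⇒SR WGE′ WGF′) GE≡GE′ GF≡GF′)
    in E′ , F′ , proj₁ (bet-inner-trans GAE′ GE′F′) , sym DE≡AE′ , sym DF≡AF′

  bet-transfer : ∀ A {D E F} → Bet D E F →
                 Σ Point λ E′ → Σ Point λ F′ → Bet A E′ F′ × len A E′ ≡ len D E × len A F′ ≡ len D F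
  bet-transfer A {D} {E} {F} DEF with em (A ≡ D)
  ... | inj₁ refl = E , F , DEF , refl , refl
  ... | inj₂ A≢D =
    let G , AG , DG = equilateral-apex A≢D
        GD≡GA = begin
          len G D ≡⟨ len-sym G D ⟩
          len D G ≡⟨ DG ⟩
          len D A ≡⟨ len-sym D A ⟩
          len A D ≡⟨ sym AG ⟩
          len A G ≡⟨ len-sym A G ⟩
          len G A ∎
        E₁ , F₁ , GDE₁ , GE₁F₁ , DE₁ , DF₁ = extend-beyond (nonzero-radius (sym DG) (A≢D ∘ sym) ∘ sym) DEF
        E′ , F′ , AE′F′ , AE′ , AF′ = rotate-onto GD≡GA (nonzero-radius (sym AG) A≢D ∘ sym) GDE₁ GE₁F₁
    in E′ , F′ , AE′F′ , trans AE′ DE₁ , trans AF′ DF₁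

  <-irrefl : ∀ a → ¬ a < a
  <-irrefl a (A , B , C , AB , AC , inj₁ ABC) =
    bet-not₂₃ ABC (proj₁ (concentric A B C C B ABC SR-ACB AB≡AC (sym AB≡AC)))
    where
    AB≡AC : len A B ≡ len A C
    AB≡AC = trans AB (sym AC)
    SR-ACB : SR A C B
    SR-ACB with bet-col ABC
    ... | z , Az , Bz , Cz = bet-neq ABC , bet-neq₁₂ ABC , (z , Az , Cz , Bz) , bet-not ABC ∘ bet-sym
  <-irrefl a (A , .A , C , AA , AC , inj₂ (refl , A≢C)) = A≢C (zero-radius (trans AC (sym AA)) refl)

  <-trans : ∀ a b c → a < b → b < c → a < c
  <-trans a b c (A , .A , C , AA , _ , inj₂ (refl , _)) (D , E , F , _ , DF , EF) =
    D , D , F , trans (len-null D A) AA , DF , inj₂ (refl , D≢F EF)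
    where
    D≢F : Bet D E F ⊎ (D ≡ E × ¬ E ≡ F) → ¬ D ≡ F
    D≢F (inj₁ DEF) = bet-neq DEF
    D≢F (inj₂ (refl , E≢F)) = E≢F
  <-trans a b c (A , B , C , _ , AC , inj₁ ABC) (D , .D , F , DD , _ , inj₂ (refl , _)) =
    ⊥-elim (bet-neq ABC (zero-radius (trans AC (trans (sym DD) (len-null D A))) refl))
  <-trans a b c (A , B , C , AB , AC , inj₁ ABC) (D , E , F , DE , DF , inj₁ DEF) =
    let E′ , F′ , AE′F′ , AE′ , AF′ = bet-transfer A DEF
        W , CAW , _ = extension (bet-neq ABC ∘ sym) C (bet-neq ABC)
        F″ , _ , AF′≡AF″ , ACF″ , _ = rotate (bet-sym CAW) AE′F′ (trans AE′ (trans DE (sym AC)))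
    in A , B , F″ , AB , trans (sym AF′≡AF″) (trans AF′ DF) , inj₁ (proj₂ (bet-inner-trans ABC ACF″))

theorem16 : {ℓ : Level} → ExcludedMiddle ℓ → (G : Geometry ℓ) →
    let open Geometry G in
    (∀ (a : Length) → ¬ (a < a)) × (∀ (a b c : Length) → a < b → b < c → a < c)
theorem16 em G = LengthOrder.<-irrefl em G , LengthOrder.<-trans em G
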